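{- Let $\mathcal{C}$ be an idempotent-complete category, let $R,S,T$ be monads on $\mathcal{C}$, let $\lambda \colon TS \Rightarrow ST$ and $\sigma \colon SR \Rightarrow RS$ be weak distributive laws, and let $\tau \colon TR \Rightarrow RT$ be a distributive law, satisfying the Yang–Baxter equation $\sigma T \circ S\tau \circ \lambda R = R\lambda \circ \tau S \circ T\sigma$. Let $S\bullet_\lambda T$ be the weak composite monad of $\lambda$, with underlying functor $K$ and splitting maps $\pi^\lambda \colon ST \Rightarrow K$, $\iota^\lambda \colon K \Rightarrow ST$. Then $$\psi \triangleq R\pi^\lambda \circ \sigma T \circ S\tau \circ \iota^\lambda R \colon KR \Rightarrow RK$$ is a weak distributive law from the monad $S\bullet_\lambda T$ over the monad $R$ (i.e. of type $[R, S\bullet_\lambda T]$). If, additionally, $\sigma$ is a distributive law, then $\psi$ is a distributive law.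
   Context: $\mathcal{C}$ is idempotent complete: every idempotent morphism (hence every idempotent natural transformation between endofunctors) splits. A monad is $(T,\eta^T,\mu^T)$. For endofunctors $A,B$, $[A,B]$ denotes the type of natural transformations $BA \Rightarrow AB$. For monads $A,B$, a natural transformation $\lambda \colon BA \Rightarrow AB$ is a distributive law if it satisfies $(\eta^+)$ $\lambda \circ B\eta^A = \eta^A B$, $(\mu^+)$ $\lambda \circ B\mu^A = \mu^A B \circ A\lambda \circ \lambda A$, $(\eta^-)$ $\lambda \circ \eta^B A = A\eta^B$, $(\mu^-)$ $\lambda \circ \mu^B A = A\mu^B \circ \lambda B \circ B\lambda$; it is a weak distributive law if it satisfies $(\eta^+)$, $(\mu^+)$, $(\mu^-)$. For a weak distributive law $\lambda \colon TS \Rightarrow ST$, the idempotent $\kappa^\lambda \triangleq S\mu^T \circ \lambda T \circ \eta^T ST \colon ST \Rightarrow ST$ splits as $\kappa^\lambda = \iota^\lambda \circ \pi^\lambda$ with $\pi^\lambda \circ \iota^\lambda = 1_K$; the weak composite monad is $S\bullet_\lambda T \triangleq (K,\ \pi^\lambda \circ \eta^S\eta^T,\ \pi^\lambda \circ \mu^S\mu^T \circ S\lambda T \circ \iota^\lambda\iota^\lambda)$. -}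

module Defs where

open import Level using (Level; _⊔_) renaming (suc to lsuc)
open import Relation.Binary using (Rel; IsEquivalence)
open import Data.Product using (Σ; _×_; _,_)

record Category (o ℓ e : Level) : Set (lsuc (o ⊔ ℓ ⊔ e)) where
  infix  4 _≈_
  infixr 9 _∘_
  field
    Obj       : Set o
    _⇒_       : Obj → Obj → Set ℓ
    _≈_       : ∀ {A B} → Rel (A ⇒ B) e
    id        : ∀ {A} → A ⇒ A
    _∘_       : ∀ {A B C} → B ⇒ C → A ⇒ B → A ⇒ C
    equiv     : ∀ {A B} → IsEquivalence (_≈_ {A} {B})
    ∘-resp-≈  : ∀ {A B C} {f h : B ⇒ C} {g i : A ⇒ B} →
                f ≈ h → g ≈ i → f ∘ g ≈ h ∘ i
    assoc     : ∀ {A B C D} {f : A ⇒ B} {g : B ⇒ C} {h : C ⇒ D} →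
                (h ∘ g) ∘ f ≈ h ∘ (g ∘ f)
    identityˡ : ∀ {A B} {f : A ⇒ B} → id ∘ f ≈ f
    identityʳ : ∀ {A B} {f : A ⇒ B} → f ∘ id ≈ f

IdempotentComplete : ∀ {o ℓ e} → Category o ℓ e → Set (o ⊔ ℓ ⊔ e)
IdempotentComplete C =
  ∀ {X} (f : X ⇒ X) → f ∘ f ≈ f →
  Σ Obj λ Y → Σ (X ⇒ Y) λ r → Σ (Y ⇒ X) λ s → (s ∘ r ≈ f) × (r ∘ s ≈ id)
  where open Category C

module _ {o ℓ e} (C : Category o ℓ e) where
  open Category C

  record Endo : Set (o ⊔ ℓ ⊔ e) where
    field
      F₀           : Obj → Obj
      F₁           : ∀ {A B} → A ⇒ B → F₀ A ⇒ F₀ B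
      identity     : ∀ {A} → F₁ (id {A}) ≈ id
      homomorphism : ∀ {A B D} {f : A ⇒ B} {g : B ⇒ D} →
                     F₁ (g ∘ f) ≈ F₁ g ∘ F₁ f
      F-resp-≈     : ∀ {A B} {f g : A ⇒ B} → f ≈ g → F₁ f ≈ F₁ g

  _∘F_ : Endo → Endo → Endo
  F ∘F G = record
    { F₀ = λ X → F.F₀ (G.F₀ X)
    ; F₁ = λ f → F.F₁ (G.F₁ f)
    ; identity = IsEquivalence.trans equiv (F.F-resp-≈ G.identity) F.identity
    ; homomorphism = IsEquivalence.trans equiv (F.F-resp-≈ G.homomorphism) F.homomorphism
    ; F-resp-≈ = λ p → F.F-resp-≈ (G.F-resp-≈ p)
    }
    where
      module F = Endo F
      module G = Endo G

  IsNatural : (F G : Endo) → (∀ X → Endo.F₀ F X ⇒ Endo.F₀ G X) → Set (o ⊔ ℓ ⊔ e)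
  IsNatural F G α = ∀ {X Y} (f : X ⇒ Y) → α Y ∘ Endo.F₁ F f ≈ Endo.F₁ G f ∘ α X

  record RawMonad : Set (o ⊔ ℓ ⊔ e) where
    field
      F : Endo
    open Endo F public
    field
      η : ∀ X → X ⇒ F₀ X
      μ : ∀ X → F₀ (F₀ X) ⇒ F₀ X

  record Monad : Set (o ⊔ ℓ ⊔ e) where
    field
      raw : RawMonad
    open RawMonad raw public
    field
      η-natural : ∀ {X Y} (f : X ⇒ Y) → η Y ∘ f ≈ F₁ f ∘ η X
      μ-natural : ∀ {X Y} (f : X ⇒ Y) → μ Y ∘ F₁ (F₁ f) ≈ F₁ f ∘ μ X
      identityˡ-μ : ∀ {X} → μ X ∘ F₁ (η X) ≈ id
      identityʳ-μ : ∀ {X} → μ X ∘ η (F₀ X) ≈ id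
      assoc-μ     : ∀ {X} → μ X ∘ F₁ (μ X) ≈ μ X ∘ μ (F₀ X)

  -- [A , B] : components of natural transformations  B A ⇒ A B

  Law : RawMonad → RawMonad → Set (o ⊔ ℓ)
  Law A B = ∀ X → RawMonad.F₀ B (RawMonad.F₀ A X) ⇒ RawMonad.F₀ A (RawMonad.F₀ B X)

  record IsWeakDistLaw (A B : RawMonad) (λ' : Law A B) : Set (o ⊔ ℓ ⊔ e) where
    private
      module A = RawMonad A
      module B = RawMonad B
    field
      natural : IsNatural (RawMonad.F B ∘F RawMonad.F A) (RawMonad.F A ∘F RawMonad.F B) λ'
      η⁺ : ∀ X → λ' X ∘ B.F₁ (A.η X) ≈ A.η (B.F₀ X)
      μ⁺ : ∀ X → λ' X ∘ B.F₁ (A.μ X) ≈ A.μ (B.F₀ X) ∘ (A.F₁ (λ' X) ∘ λ' (A.F₀ X))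
      μ⁻ : ∀ X → λ' X ∘ B.μ (A.F₀ X) ≈ A.F₁ (B.μ X) ∘ (λ' (B.F₀ X) ∘ B.F₁ (λ' X))

  record IsDistLaw (A B : RawMonad) (λ' : Law A B) : Set (o ⊔ ℓ ⊔ e) where
    private
      module A = RawMonad A
      module B = RawMonad B
    field
      weak : IsWeakDistLaw A B λ'
      η⁻   : ∀ X → λ' X ∘ B.η (A.F₀ X) ≈ A.F₁ (B.η X)
    open IsWeakDistLaw weak public

  module _ (S T : Monad) (λ' : Law (Monad.raw S) (Monad.raw T)) where
    private
      module S = Monad S
      module T = Monad T

    ST : Endo
    ST = S.F ∘F T.F

    κ : ∀ X → S.F₀ (T.F₀ X) ⇒ S.F₀ (T.F₀ X)
    κ X = S.F₁ (T.μ X) ∘ (λ' (T.F₀ X) ∘ T.η (S.F₀ (T.F₀ X)))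

    record Splitting : Set (o ⊔ ℓ ⊔ e) where
      field
        K       : Endo
      open Endo K public
      field
        π       : ∀ X → S.F₀ (T.F₀ X) ⇒ F₀ X
        ι       : ∀ X → F₀ X ⇒ S.F₀ (T.F₀ X)
        π-natural : IsNatural ST K π
        ι-natural : IsNatural K ST ι
        ι∘π≈κ   : ∀ X → ι X ∘ π X ≈ κ X
        π∘ι≈id  : ∀ X → π X ∘ ι X ≈ id

    weakComposite : Splitting → RawMonad
    weakComposite sp = record
      { F = K
      ; η = λ X → π X ∘ (S.F₁ (T.η X) ∘ S.η X)
      ; μ = λ X → π X ∘ ((S.F₁ (T.μ X) ∘ S.μ (T.F₀ (T.F₀ X)))
                      ∘ (S.F₁ (λ' (T.F₀ X))
                      ∘ (S.F₁ (T.F₁ (ι X)) ∘ ι (K₀ X))))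
      }
      where
        open Splitting sp
        K₀ = Endo.F₀ K

  YangBaxter : (R S T : Monad) →
               Law (Monad.raw S) (Monad.raw T) →
               Law (Monad.raw R) (Monad.raw S) →
               Law (Monad.raw R) (Monad.raw T) → Set (o ⊔ e)
  YangBaxter R S T λ' σ τ = ∀ X →
    σ (T.F₀ X) ∘ (S.F₁ (τ X) ∘ λ' (R.F₀ X))
      ≈ R.F₁ (λ' X) ∘ (τ (S.F₀ X) ∘ T.F₁ (σ X))
    where
      module R = Monad R
      module S = Monad S
      module T = Monad T

  ψ : (R S T : Monad) (λ' : Law (Monad.raw S) (Monad.raw T)) →
      Law (Monad.raw R) (Monad.raw S) → Law (Monad.raw R) (Monad.raw T) →
      (sp : Splitting S T λ') →
      Law (Monad.raw R) (weakComposite S T λ' sp)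
  ψ R S T λ' σ τ sp X =
    R.F₁ (π X) ∘ (σ (T.F₀ X) ∘ (S.F₁ (τ X) ∘ ι (R.F₀ X)))
    where
      module R = Monad R
      module S = Monad S
      module T = Monad T
      open Splitting sp

{-# OPTIONS --safe #-}

-- The composite φ = σT ∘ Sτ : STR ⇒ RST of σ and τ is natural and satisfies
-- (η⁺) and (μ⁺) over R.  The Yang–Baxter equation, together with (μ⁻) and (η⁻)
-- of τ and only the naturality of λ, makes φ commute with the idempotent
-- κ = Sμᵀ ∘ λT ∘ ηᵀST and with the multiplication Sμᵀ ∘ μˢTT ∘ SλT of ST.
-- Because φ commutes with κ = ι ∘ π, its restriction ψ = Rπ ∘ φ ∘ ιR to the
-- retract K satisfies Rι ∘ ψ = φ ∘ ιR and ψ ∘ πR = Rπ ∘ φ, and these two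
-- equations carry each axiom of φ over to ψ.  If σ also satisfies (η⁻), so
-- does φ for the unit Sηᵀ ∘ ηˢ, and hence so does ψ.

module Submission where

open import Data.Product using (_×_; _,_)
open import Relation.Binary using (IsEquivalence; Setoid)
import Relation.Binary.Reasoning.Setoid as SetoidReasoning
open import Defs

module HomReasoning {o ℓ e} (C : Category o ℓ e) where
  open Category C public
  module ≈ {A B : Obj} = IsEquivalence (equiv {A} {B})
  open ≈ public using (refl; sym; trans)

  hom-setoid : ∀ {A B} → Setoid ℓ e
  hom-setoid {A} {B} = record { Carrier = A ⇒ B ; _≈_ = _≈_ ; isEquivalence = equiv }

  module _ {A B : Obj} where
    open SetoidReasoning (hom-setoid {A} {B}) public

  private
    variable
      A B D E G : Obj

  infixr 4 refl⟩∘⟨_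
  infixl 5 _⟩∘⟨refl
  infixr 3 _○_

  _○_ : {f g h : A ⇒ B} → f ≈ g → g ≈ h → f ≈ h
  _○_ = trans

  refl⟩∘⟨_ : {f : B ⇒ D} {g h : A ⇒ B} → g ≈ h → f ∘ g ≈ f ∘ h
  refl⟩∘⟨ p = ∘-resp-≈ refl p

  _⟩∘⟨refl : {f g : B ⇒ D} {h : A ⇒ B} → f ≈ g → f ∘ h ≈ g ∘ h
  p ⟩∘⟨refl = ∘-resp-≈ p refl

  sym-assoc : {f : A ⇒ B} {g : B ⇒ D} {h : D ⇒ E} → h ∘ (g ∘ f) ≈ (h ∘ g) ∘ f
  sym-assoc = sym assoc

  assoc²′ : {f : A ⇒ B} {g : B ⇒ D} {h : D ⇒ E} {k : E ⇒ G} →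
            (k ∘ (h ∘ g)) ∘ f ≈ k ∘ (h ∘ (g ∘ f))
  assoc²′ = assoc ○ refl⟩∘⟨ assoc

  pullˡ : {a : B ⇒ D} {b : A ⇒ B} {c : A ⇒ D} {f : E ⇒ A} →
          a ∘ b ≈ c → a ∘ (b ∘ f) ≈ c ∘ f
  pullˡ p = sym-assoc ○ p ⟩∘⟨refl

  pullʳ : {a : B ⇒ D} {b : A ⇒ B} {f : E ⇒ A} {c : E ⇒ B} →
          b ∘ f ≈ c → (a ∘ b) ∘ f ≈ a ∘ c
  pullʳ p = assoc ○ refl⟩∘⟨ p

  extendʳ : {a : B ⇒ D} {b : A ⇒ B} {c : G ⇒ D} {d : A ⇒ G} {f : E ⇒ A} →
            a ∘ b ≈ c ∘ d → a ∘ (b ∘ f) ≈ c ∘ (d ∘ f)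
  extendʳ p = pullˡ p ○ assoc

  cancelʳ : {a : B ⇒ D} {b : A ⇒ B} {f : B ⇒ A} → b ∘ f ≈ id → (a ∘ b) ∘ f ≈ a
  cancelʳ p = pullʳ p ○ identityʳ

  cancelˡ : {a : B ⇒ A} {b : A ⇒ B} {f : E ⇒ A} → a ∘ b ≈ id → a ∘ (b ∘ f) ≈ f
  cancelˡ p = pullˡ p ○ identityˡ

  module _ (F : Endo C) where
    open Endo F

    [_]-resp-∘ : {g : B ⇒ D} {f : A ⇒ B} {h : A ⇒ D} →
                 g ∘ f ≈ h → F₁ g ∘ F₁ f ≈ F₁ h
    [_]-resp-∘ p = sym homomorphism ○ F-resp-≈ p

    [_]-resp-square : {g : B ⇒ D} {f : A ⇒ B} {k : E ⇒ D} {h : A ⇒ E} →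
                      g ∘ f ≈ k ∘ h → F₁ g ∘ F₁ f ≈ F₁ k ∘ F₁ h
    [_]-resp-square p = [_]-resp-∘ p ○ homomorphism

    [_]-homomorphism³ : {f : A ⇒ B} {g : B ⇒ D} {h : D ⇒ E} →
                        F₁ (h ∘ (g ∘ f)) ≈ F₁ h ∘ (F₁ g ∘ F₁ f)
    [_]-homomorphism³ = homomorphism ○ refl⟩∘⟨ homomorphism

module _ {o ℓ e} {C : Category o ℓ e} where
  open HomReasoning C

  module Restriction {A A′ B B′} {p : A ⇒ A′} {i : A′ ⇒ A} {q : B ⇒ B′} {j : B′ ⇒ B}
    (p∘i≈id : p ∘ i ≈ id) (q∘j≈id : q ∘ j ≈ id)
    (f : A ⇒ B) (f-intertwines : f ∘ (i ∘ p) ≈ (j ∘ q) ∘ f) where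

    restrict : A′ ⇒ B′
    restrict = q ∘ (f ∘ i)

    j∘restrict≈f∘i : j ∘ restrict ≈ f ∘ i
    j∘restrict≈f∘i = begin
      j ∘ (q ∘ (f ∘ i))    ≈⟨ sym-assoc ○ sym-assoc ⟩
      ((j ∘ q) ∘ f) ∘ i    ≈⟨ sym f-intertwines ⟩∘⟨refl ⟩
      (f ∘ (i ∘ p)) ∘ i    ≈⟨ pullʳ (cancelʳ p∘i≈id) ⟩
      f ∘ i                ∎

    restrict∘p≈q∘f : restrict ∘ p ≈ q ∘ f
    restrict∘p≈q∘f = begin
      (q ∘ (f ∘ i)) ∘ p    ≈⟨ pullʳ assoc ⟩
      q ∘ (f ∘ (i ∘ p))    ≈⟨ refl⟩∘⟨ f-intertwines ⟩
      q ∘ ((j ∘ q) ∘ f)    ≈⟨ refl⟩∘⟨ assoc ○ cancelˡ q∘j≈id ⟩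
      q ∘ f                ∎

module CompositeLaw {o ℓ e} {C : Category o ℓ e} (R S T : Monad C)
  (σ : Law C (Monad.raw R) (Monad.raw S)) (τ : Law C (Monad.raw R) (Monad.raw T))
  (σ-weak : IsWeakDistLaw C (Monad.raw R) (Monad.raw S) σ)
  (τ-dist : IsDistLaw C (Monad.raw R) (Monad.raw T) τ) where

  open HomReasoning C
  private
    module R = Monad R
    module S = Monad S
    module T = Monad T
    module σ = IsWeakDistLaw σ-weak
    module τ = IsDistLaw τ-dist

  φ : ∀ X → S.F₀ (T.F₀ (R.F₀ X)) ⇒ R.F₀ (S.F₀ (T.F₀ X))
  φ X = σ (T.F₀ X) ∘ S.F₁ (τ X)

  φ-natural : ∀ {X Y} (f : X ⇒ Y) → φ Y ∘ S.F₁ (T.F₁ (R.F₁ f)) ≈ R.F₁ (S.F₁ (T.F₁ f)) ∘ φ X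
  φ-natural {X} {Y} f = begin
    (σ (T.F₀ Y) ∘ S.F₁ (τ Y)) ∘ S.F₁ (T.F₁ (R.F₁ f))
      ≈⟨ pullʳ ([ S.F ]-resp-square (τ.natural f)) ⟩
    σ (T.F₀ Y) ∘ (S.F₁ (R.F₁ (T.F₁ f)) ∘ S.F₁ (τ X))
      ≈⟨ extendʳ (σ.natural (T.F₁ f)) ⟩
    R.F₁ (S.F₁ (T.F₁ f)) ∘ φ X
      ∎

  φ-η⁺ : ∀ X → φ X ∘ S.F₁ (T.F₁ (R.η X)) ≈ R.η (S.F₀ (T.F₀ X))
  φ-η⁺ X = pullʳ ([ S.F ]-resp-∘ (τ.η⁺ X)) ○ σ.η⁺ (T.F₀ X)

  φ-μ⁺ : ∀ X → φ X ∘ S.F₁ (T.F₁ (R.μ X)) ≈ R.μ (S.F₀ (T.F₀ X)) ∘ (R.F₁ (φ X) ∘ φ (R.F₀ X))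
  φ-μ⁺ X = begin
    φ X ∘ S.F₁ (T.F₁ (R.μ X))
      ≈⟨ pullʳ ([ S.F ]-resp-∘ (τ.μ⁺ X)) ○ refl⟩∘⟨ [ S.F ]-homomorphism³ ⟩
    σ _ ∘ (S.F₁ (R.μ (T.F₀ X)) ∘ (S.F₁ (R.F₁ (τ X)) ∘ S.F₁ (τ (R.F₀ X))))
      ≈⟨ pullˡ (σ.μ⁺ (T.F₀ X)) ○ assoc²′ ⟩
    R.μ _ ∘ (R.F₁ (σ _) ∘ (σ _ ∘ (S.F₁ (R.F₁ (τ X)) ∘ S.F₁ (τ (R.F₀ X)))))
      ≈⟨ refl⟩∘⟨ refl⟩∘⟨ extendʳ (σ.natural (τ X)) ⟩
    R.μ _ ∘ (R.F₁ (σ _) ∘ (R.F₁ (S.F₁ (τ X)) ∘ φ (R.F₀ X)))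
      ≈⟨ refl⟩∘⟨ pullˡ (sym R.homomorphism) ⟩
    R.μ _ ∘ (R.F₁ (φ X) ∘ φ (R.F₀ X))
      ∎

  φ-Sμᵀ : ∀ X → φ X ∘ S.F₁ (T.μ (R.F₀ X))
                  ≈ R.F₁ (S.F₁ (T.μ X)) ∘ (φ (T.F₀ X) ∘ S.F₁ (T.F₁ (τ X)))
  φ-Sμᵀ X = begin
    φ X ∘ S.F₁ (T.μ (R.F₀ X))
      ≈⟨ pullʳ ([ S.F ]-resp-∘ (τ.μ⁻ X)) ○ refl⟩∘⟨ [ S.F ]-homomorphism³ ⟩
    σ _ ∘ (S.F₁ (R.F₁ (T.μ X)) ∘ (S.F₁ (τ (T.F₀ X)) ∘ S.F₁ (T.F₁ (τ X))))
      ≈⟨ extendʳ (σ.natural (T.μ X)) ⟩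
    R.F₁ (S.F₁ (T.μ X)) ∘ (σ _ ∘ (S.F₁ (τ (T.F₀ X)) ∘ S.F₁ (T.F₁ (τ X))))
      ≈⟨ refl⟩∘⟨ sym-assoc ⟩
    R.F₁ (S.F₁ (T.μ X)) ∘ (φ (T.F₀ X) ∘ S.F₁ (T.F₁ (τ X)))
      ∎

  φ-μˢ : ∀ X → φ X ∘ S.μ (T.F₀ (R.F₀ X))
                 ≈ R.F₁ (S.μ (T.F₀ X)) ∘ (σ (S.F₀ (T.F₀ X)) ∘ S.F₁ (φ X))
  φ-μˢ X = begin
    φ X ∘ S.μ (T.F₀ (R.F₀ X))
      ≈⟨ pullʳ (sym (S.μ-natural (τ X))) ⟩
    σ _ ∘ (S.μ (R.F₀ (T.F₀ X)) ∘ S.F₁ (S.F₁ (τ X)))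
      ≈⟨ pullˡ (σ.μ⁻ (T.F₀ X)) ○ assoc²′ ⟩
    R.F₁ (S.μ (T.F₀ X)) ∘ (σ _ ∘ (S.F₁ (σ (T.F₀ X)) ∘ S.F₁ (S.F₁ (τ X))))
      ≈⟨ refl⟩∘⟨ refl⟩∘⟨ sym S.homomorphism ⟩
    R.F₁ (S.μ (T.F₀ X)) ∘ (σ _ ∘ S.F₁ (φ X))
      ∎

  φ-η⁻ : IsDistLaw C (Monad.raw R) (Monad.raw S) σ →
         ∀ X → φ X ∘ (S.F₁ (T.η (R.F₀ X)) ∘ S.η (R.F₀ X)) ≈ R.F₁ (S.F₁ (T.η X) ∘ S.η X)
  φ-η⁻ σ-dist X = begin
    φ X ∘ (S.F₁ (T.η (R.F₀ X)) ∘ S.η (R.F₀ X))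
      ≈⟨ pullʳ (pullˡ ([ S.F ]-resp-∘ (τ.η⁻ X))) ⟩
    σ _ ∘ (S.F₁ (R.F₁ (T.η X)) ∘ S.η (R.F₀ X))
      ≈⟨ extendʳ (σ.natural (T.η X)) ⟩
    R.F₁ (S.F₁ (T.η X)) ∘ (σ _ ∘ S.η (R.F₀ X))
      ≈⟨ refl⟩∘⟨ IsDistLaw.η⁻ σ-dist X ⟩
    R.F₁ (S.F₁ (T.η X)) ∘ R.F₁ (S.η X)
      ≈⟨ sym R.homomorphism ⟩
    R.F₁ (S.F₁ (T.η X) ∘ S.η X)
      ∎

  module WithYangBaxter (λ' : Law C (Monad.raw S) (Monad.raw T))
    (λ-natural : ∀ {X Y} (f : X ⇒ Y) → λ' Y ∘ T.F₁ (S.F₁ f) ≈ S.F₁ (T.F₁ f) ∘ λ' X)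
    (yang-baxter : YangBaxter C R S T λ' σ τ) where

    μ̂ : ∀ X → S.F₀ (T.F₀ (S.F₀ (T.F₀ X))) ⇒ S.F₀ (T.F₀ X)
    μ̂ X = S.F₁ (T.μ X) ∘ (S.μ (T.F₀ (T.F₀ X)) ∘ S.F₁ (λ' (T.F₀ X)))

    φ-yang-baxter : ∀ X → φ (T.F₀ X) ∘ (S.F₁ (T.F₁ (τ X)) ∘ λ' (T.F₀ (R.F₀ X)))
                            ≈ R.F₁ (λ' (T.F₀ X)) ∘ (τ (S.F₀ (T.F₀ X)) ∘ T.F₁ (φ X))
    φ-yang-baxter X = begin
      φ (T.F₀ X) ∘ (S.F₁ (T.F₁ (τ X)) ∘ λ' _)
        ≈⟨ refl⟩∘⟨ sym (λ-natural (τ X)) ⟩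
      (σ _ ∘ S.F₁ (τ _)) ∘ (λ' _ ∘ T.F₁ (S.F₁ (τ X)))
        ≈⟨ assoc ○ sym assoc²′ ⟩
      (σ _ ∘ (S.F₁ (τ _) ∘ λ' _)) ∘ T.F₁ (S.F₁ (τ X))
        ≈⟨ yang-baxter (T.F₀ X) ⟩∘⟨refl ⟩
      (R.F₁ (λ' _) ∘ (τ _ ∘ T.F₁ (σ _))) ∘ T.F₁ (S.F₁ (τ X))
        ≈⟨ assoc²′ ○ refl⟩∘⟨ refl⟩∘⟨ sym T.homomorphism ⟩
      R.F₁ (λ' _) ∘ (τ _ ∘ T.F₁ (φ X))
        ∎

    φ-κ : ∀ X → φ X ∘ κ C S T λ' (R.F₀ X) ≈ R.F₁ (κ C S T λ' X) ∘ φ X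
    φ-κ X = begin
      φ X ∘ (S.F₁ (T.μ _) ∘ (λ' _ ∘ T.η _))
        ≈⟨ sym-assoc ○ φ-Sμᵀ X ⟩∘⟨refl ○ assoc²′ ⟩
      R.F₁ (S.F₁ (T.μ X)) ∘ (φ (T.F₀ X) ∘ (S.F₁ (T.F₁ (τ X)) ∘ (λ' _ ∘ T.η _)))
        ≈⟨ refl⟩∘⟨ refl⟩∘⟨ sym-assoc ○ refl⟩∘⟨ sym-assoc ⟩
      R.F₁ (S.F₁ (T.μ X)) ∘ ((φ (T.F₀ X) ∘ (S.F₁ (T.F₁ (τ X)) ∘ λ' _)) ∘ T.η _)
        ≈⟨ refl⟩∘⟨ (φ-yang-baxter X ⟩∘⟨refl ○ assoc²′) ⟩
      R.F₁ (S.F₁ (T.μ X)) ∘ (R.F₁ (λ' _) ∘ (τ _ ∘ (T.F₁ (φ X) ∘ T.η _)))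
        ≈⟨ refl⟩∘⟨ refl⟩∘⟨ refl⟩∘⟨ sym (T.η-natural (φ X)) ⟩
      R.F₁ (S.F₁ (T.μ X)) ∘ (R.F₁ (λ' _) ∘ (τ _ ∘ (T.η _ ∘ φ X)))
        ≈⟨ refl⟩∘⟨ refl⟩∘⟨ pullˡ (τ.η⁻ _) ⟩
      R.F₁ (S.F₁ (T.μ X)) ∘ (R.F₁ (λ' _) ∘ (R.F₁ (T.η _) ∘ φ X))
        ≈⟨ sym assoc²′ ○ sym [ R.F ]-homomorphism³ ⟩∘⟨refl ⟩
      R.F₁ (κ C S T λ' X) ∘ φ X
        ∎

    φ-μˢ∘Sλ : ∀ X → φ (T.F₀ X) ∘ (S.F₁ (T.F₁ (τ X))
                                  ∘ (S.μ (T.F₀ (T.F₀ (R.F₀ X))) ∘ S.F₁ (λ' (T.F₀ (R.F₀ X)))))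
                      ≈ R.F₁ (S.μ (T.F₀ (T.F₀ X)))
                        ∘ (R.F₁ (S.F₁ (λ' (T.F₀ X))) ∘ (φ (S.F₀ (T.F₀ X)) ∘ S.F₁ (T.F₁ (φ X))))
    φ-μˢ∘Sλ X = begin
      φ _ ∘ (S.F₁ (T.F₁ (τ X)) ∘ (S.μ _ ∘ S.F₁ (λ' _)))
        ≈⟨ refl⟩∘⟨ extendʳ (sym (S.μ-natural (T.F₁ (τ X)))) ⟩
      φ _ ∘ (S.μ _ ∘ (S.F₁ (S.F₁ (T.F₁ (τ X))) ∘ S.F₁ (λ' _)))
        ≈⟨ pullˡ (φ-μˢ (T.F₀ X)) ○ assoc²′ ⟩
      R.F₁ (S.μ _) ∘ (σ _ ∘ (S.F₁ (φ _) ∘ (S.F₁ (S.F₁ (T.F₁ (τ X))) ∘ S.F₁ (λ' _))))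
        ≈⟨ refl⟩∘⟨ refl⟩∘⟨ (sym [ S.F ]-homomorphism³
                            ○ S.F-resp-≈ (φ-yang-baxter X) ○ [ S.F ]-homomorphism³) ⟩
      R.F₁ (S.μ _) ∘ (σ _ ∘ (S.F₁ (R.F₁ (λ' _)) ∘ (S.F₁ (τ _) ∘ S.F₁ (T.F₁ (φ X)))))
        ≈⟨ refl⟩∘⟨ extendʳ (σ.natural (λ' (T.F₀ X))) ⟩
      R.F₁ (S.μ _) ∘ (R.F₁ (S.F₁ (λ' _)) ∘ (σ _ ∘ (S.F₁ (τ _) ∘ S.F₁ (T.F₁ (φ X)))))
        ≈⟨ refl⟩∘⟨ refl⟩∘⟨ sym-assoc ⟩
      R.F₁ (S.μ _) ∘ (R.F₁ (S.F₁ (λ' _)) ∘ (φ _ ∘ S.F₁ (T.F₁ (φ X))))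
        ∎

    φ-μ̂ : ∀ X → φ X ∘ μ̂ (R.F₀ X) ≈ R.F₁ (μ̂ X) ∘ (φ (S.F₀ (T.F₀ X)) ∘ S.F₁ (T.F₁ (φ X)))
    φ-μ̂ X = begin
      φ X ∘ (S.F₁ (T.μ _) ∘ (S.μ _ ∘ S.F₁ (λ' _)))
        ≈⟨ sym-assoc ○ φ-Sμᵀ X ⟩∘⟨refl ○ assoc²′ ⟩
      R.F₁ (S.F₁ (T.μ X)) ∘ (φ _ ∘ (S.F₁ (T.F₁ (τ X)) ∘ (S.μ _ ∘ S.F₁ (λ' _))))
        ≈⟨ refl⟩∘⟨ φ-μˢ∘Sλ X ⟩
      R.F₁ (S.F₁ (T.μ X)) ∘ (R.F₁ (S.μ _) ∘ (R.F₁ (S.F₁ (λ' _)) ∘ (φ _ ∘ S.F₁ (T.F₁ (φ X)))))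
        ≈⟨ sym assoc²′ ○ sym [ R.F ]-homomorphism³ ⟩∘⟨refl ⟩
      R.F₁ (μ̂ X) ∘ (φ _ ∘ S.F₁ (T.F₁ (φ X)))
        ∎

    module OnWeakComposite (sp : Splitting C S T λ') where
      private
        module K = Splitting sp
        W = weakComposite C S T λ' sp
        module W = RawMonad W

      ψ′ : Law C (Monad.raw R) W
      ψ′ = ψ C R S T λ' σ τ sp

      ψ≈Rπ∘φ∘ι : ∀ X → ψ′ X ≈ R.F₁ (K.π X) ∘ (φ X ∘ K.ι (R.F₀ X))
      ψ≈Rπ∘φ∘ι X = refl⟩∘⟨ sym-assoc

      φ-intertwines-ι∘π : ∀ X → φ X ∘ (K.ι (R.F₀ X) ∘ K.π (R.F₀ X))
                                  ≈ (R.F₁ (K.ι X) ∘ R.F₁ (K.π X)) ∘ φ X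
      φ-intertwines-ι∘π X =
        refl⟩∘⟨ K.ι∘π≈κ _ ○ φ-κ X ○ sym ([ R.F ]-resp-∘ (K.ι∘π≈κ X)) ⟩∘⟨refl

      private
        module ψ-restriction (X : Obj) = Restriction {C = C} (K.π∘ι≈id (R.F₀ X))
          ([ R.F ]-resp-∘ (K.π∘ι≈id X) ○ R.identity) (φ X) (φ-intertwines-ι∘π X)

      Rι∘ψ≈φ∘ι : ∀ X → R.F₁ (K.ι X) ∘ ψ′ X ≈ φ X ∘ K.ι (R.F₀ X)
      Rι∘ψ≈φ∘ι X = refl⟩∘⟨ ψ≈Rπ∘φ∘ι X ○ ψ-restriction.j∘restrict≈f∘i X

      ψ∘π≈Rπ∘φ : ∀ X → ψ′ X ∘ K.π (R.F₀ X) ≈ R.F₁ (K.π X) ∘ φ X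
      ψ∘π≈Rπ∘φ X = ψ≈Rπ∘φ∘ι X ⟩∘⟨refl ○ ψ-restriction.restrict∘p≈q∘f X

      ι² : ∀ X → K.F₀ (K.F₀ X) ⇒ S.F₀ (T.F₀ (S.F₀ (T.F₀ X)))
      ι² X = S.F₁ (T.F₁ (K.ι X)) ∘ K.ι (K.F₀ X)

      μᴷ≈π∘μ̂∘ι² : ∀ X → W.μ X ≈ K.π X ∘ (μ̂ X ∘ ι² X)
      μᴷ≈π∘μ̂∘ι² X = refl⟩∘⟨ (assoc ○ sym assoc²′)

      Rι²∘ψ∘Kψ≈φ∘STφ∘ι² : ∀ X → R.F₁ (ι² X) ∘ (ψ′ (K.F₀ X) ∘ K.F₁ (ψ′ X))
                                  ≈ φ (S.F₀ (T.F₀ X)) ∘ (S.F₁ (T.F₁ (φ X)) ∘ ι² (R.F₀ X))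
      Rι²∘ψ∘Kψ≈φ∘STφ∘ι² X = begin
        R.F₁ (S.F₁ (T.F₁ (K.ι X)) ∘ K.ι _) ∘ (ψ′ _ ∘ K.F₁ (ψ′ X))
          ≈⟨ R.homomorphism ⟩∘⟨refl ○ assoc ⟩
        R.F₁ (S.F₁ (T.F₁ (K.ι X))) ∘ (R.F₁ (K.ι _) ∘ (ψ′ _ ∘ K.F₁ (ψ′ X)))
          ≈⟨ refl⟩∘⟨ (pullˡ (Rι∘ψ≈φ∘ι (K.F₀ X)) ○ assoc) ⟩
        R.F₁ (S.F₁ (T.F₁ (K.ι X))) ∘ (φ _ ∘ (K.ι _ ∘ K.F₁ (ψ′ X)))
          ≈⟨ extendʳ (sym (φ-natural (K.ι X))) ○ refl⟩∘⟨ refl⟩∘⟨ K.ι-natural (ψ′ X) ⟩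
        φ _ ∘ (S.F₁ (T.F₁ (R.F₁ (K.ι X))) ∘ (S.F₁ (T.F₁ (ψ′ X)) ∘ K.ι _))
          ≈⟨ refl⟩∘⟨ extendʳ ([ S.F ]-resp-square ([ T.F ]-resp-square (Rι∘ψ≈φ∘ι X))) ⟩
        φ _ ∘ (S.F₁ (T.F₁ (φ X)) ∘ ι² (R.F₀ X))
          ∎

      ψ-natural : ∀ {X Y} (f : X ⇒ Y) → ψ′ Y ∘ K.F₁ (R.F₁ f) ≈ R.F₁ (K.F₁ f) ∘ ψ′ X
      ψ-natural {X} {Y} f = begin
        ψ′ Y ∘ K.F₁ (R.F₁ f)
          ≈⟨ ψ≈Rπ∘φ∘ι Y ⟩∘⟨refl ○ pullʳ (pullʳ (K.ι-natural (R.F₁ f))) ⟩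
        R.F₁ (K.π Y) ∘ (φ Y ∘ (S.F₁ (T.F₁ (R.F₁ f)) ∘ K.ι _))
          ≈⟨ refl⟩∘⟨ extendʳ (φ-natural f) ⟩
        R.F₁ (K.π Y) ∘ (R.F₁ (S.F₁ (T.F₁ f)) ∘ (φ X ∘ K.ι _))
          ≈⟨ extendʳ ([ R.F ]-resp-square (K.π-natural f)) ○ refl⟩∘⟨ sym (ψ≈Rπ∘φ∘ι X) ⟩
        R.F₁ (K.F₁ f) ∘ ψ′ X
          ∎

      ψ-η⁺ : ∀ X → ψ′ X ∘ K.F₁ (R.η X) ≈ R.η (K.F₀ X)
      ψ-η⁺ X = begin
        ψ′ X ∘ K.F₁ (R.η X)
          ≈⟨ ψ≈Rπ∘φ∘ι X ⟩∘⟨refl ○ pullʳ (pullʳ (K.ι-natural (R.η X))) ⟩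
        R.F₁ (K.π X) ∘ (φ X ∘ (S.F₁ (T.F₁ (R.η X)) ∘ K.ι X))
          ≈⟨ refl⟩∘⟨ pullˡ (φ-η⁺ X) ⟩
        R.F₁ (K.π X) ∘ (R.η _ ∘ K.ι X)
          ≈⟨ pullˡ (sym (R.η-natural (K.π X))) ○ cancelʳ (K.π∘ι≈id X) ⟩
        R.η (K.F₀ X)
          ∎

      ψ-μ⁺ : ∀ X → ψ′ X ∘ K.F₁ (R.μ X) ≈ R.μ (K.F₀ X) ∘ (R.F₁ (ψ′ X) ∘ ψ′ (R.F₀ X))
      ψ-μ⁺ X = begin
        ψ′ X ∘ K.F₁ (R.μ X)
          ≈⟨ ψ≈Rπ∘φ∘ι X ⟩∘⟨refl ○ pullʳ (pullʳ (K.ι-natural (R.μ X))) ⟩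
        R.F₁ (K.π X) ∘ (φ X ∘ (S.F₁ (T.F₁ (R.μ X)) ∘ K.ι _))
          ≈⟨ refl⟩∘⟨ (pullˡ (φ-μ⁺ X) ○ assoc²′) ⟩
        R.F₁ (K.π X) ∘ (R.μ _ ∘ (R.F₁ (φ X) ∘ (φ _ ∘ K.ι _)))
          ≈⟨ extendʳ (sym (R.μ-natural (K.π X))) ⟩
        R.μ _ ∘ (R.F₁ (R.F₁ (K.π X)) ∘ (R.F₁ (φ X) ∘ (φ _ ∘ K.ι _)))
          ≈⟨ refl⟩∘⟨ pullˡ ([ R.F ]-resp-∘ (sym (ψ∘π≈Rπ∘φ X))) ⟩
        R.μ _ ∘ (R.F₁ (ψ′ X ∘ K.π _) ∘ (φ _ ∘ K.ι _))
          ≈⟨ refl⟩∘⟨ (R.homomorphism ⟩∘⟨refl ○ assoc ○ refl⟩∘⟨ sym (ψ≈Rπ∘φ∘ι (R.F₀ X))) ⟩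
        R.μ (K.F₀ X) ∘ (R.F₁ (ψ′ X) ∘ ψ′ (R.F₀ X))
          ∎

      ψ-μ⁻ : ∀ X → ψ′ X ∘ W.μ (R.F₀ X) ≈ R.F₁ (W.μ X) ∘ (ψ′ (K.F₀ X) ∘ K.F₁ (ψ′ X))
      ψ-μ⁻ X = begin
        ψ′ X ∘ W.μ (R.F₀ X)
          ≈⟨ refl⟩∘⟨ μᴷ≈π∘μ̂∘ι² (R.F₀ X) ○ pullˡ (ψ∘π≈Rπ∘φ X) ○ assoc ⟩
        R.F₁ (K.π X) ∘ (φ X ∘ (μ̂ _ ∘ ι² _))
          ≈⟨ refl⟩∘⟨ (pullˡ (φ-μ̂ X) ○ assoc²′) ⟩
        R.F₁ (K.π X) ∘ (R.F₁ (μ̂ X) ∘ (φ _ ∘ (S.F₁ (T.F₁ (φ X)) ∘ ι² _)))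
          ≈⟨ refl⟩∘⟨ refl⟩∘⟨ sym (Rι²∘ψ∘Kψ≈φ∘STφ∘ι² X) ⟩
        R.F₁ (K.π X) ∘ (R.F₁ (μ̂ X) ∘ (R.F₁ (ι² X) ∘ (ψ′ _ ∘ K.F₁ (ψ′ X))))
          ≈⟨ sym assoc²′ ○ (sym [ R.F ]-homomorphism³ ○ R.F-resp-≈ (sym (μᴷ≈π∘μ̂∘ι² X))) ⟩∘⟨refl ⟩
        R.F₁ (W.μ X) ∘ (ψ′ (K.F₀ X) ∘ K.F₁ (ψ′ X))
          ∎

      ψ-η⁻ : IsDistLaw C (Monad.raw R) (Monad.raw S) σ →
             ∀ X → ψ′ X ∘ W.η (R.F₀ X) ≈ R.F₁ (W.η X)
      ψ-η⁻ σ-dist X =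
        pullˡ (ψ∘π≈Rπ∘φ X) ○ pullʳ (φ-η⁻ σ-dist X) ○ sym R.homomorphism

      ψ-weak : IsWeakDistLaw C (Monad.raw R) W ψ′
      ψ-weak = record { natural = ψ-natural ; η⁺ = ψ-η⁺ ; μ⁺ = ψ-μ⁺ ; μ⁻ = ψ-μ⁻ }

theorem4p5 : ∀ {o ℓ e} (C : Category o ℓ e) → IdempotentComplete C →
    (R S T : Monad C)
    (λ' : Law C (Monad.raw S) (Monad.raw T))
    (σ : Law C (Monad.raw R) (Monad.raw S))
    (τ : Law C (Monad.raw R) (Monad.raw T)) →
    IsWeakDistLaw C (Monad.raw S) (Monad.raw T) λ' →
    IsWeakDistLaw C (Monad.raw R) (Monad.raw S) σ →
    IsDistLaw C (Monad.raw R) (Monad.raw T) τ →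
    YangBaxter C R S T λ' σ τ →
    (sp : Splitting C S T λ') →
    IsWeakDistLaw C (Monad.raw R) (weakComposite C S T λ' sp) (ψ C R S T λ' σ τ sp)
    × (IsDistLaw C (Monad.raw R) (Monad.raw S) σ →
       IsDistLaw C (Monad.raw R) (weakComposite C S T λ' sp) (ψ C R S T λ' σ τ sp))
theorem4p5 C _ R S T λ' σ τ λ-weak σ-weak τ-dist yang-baxter sp =
  ψ-weak , λ σ-dist → record { weak = ψ-weak ; η⁻ = ψ-η⁻ σ-dist }
  where
    open CompositeLaw.WithYangBaxter.OnWeakComposite R S T σ τ σ-weak τ-dist
           λ' (IsWeakDistLaw.natural λ-weak) yang-baxter sp
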